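{- Let $t$ be a $\lambda$-term in de Bruijn notation. Then $t:[]$ is derivable in the $\mathcal{L}$-type system described in the context if and only if $t$ is closed and linear.
   Context: Terms with implicit names (de Bruijn notation) are given by $t ::= \underline{n} \mid \lambda t \mid t\,t$ with $n\in\mathbb{N}$. An occurrence of $\underline{k}$ lying under $d$ abstractions refers to the $(k+1)$-th enclosing abstraction if $k<d$ (it is bound), and otherwise it is free. A term is closed if it has no free index occurrences, and a closed term is linear if every abstraction in it has exactly one index occurrence referring to it. $\mathcal{L}$-types are finite lists of natural numbers. The partial merge $\ddagger$: $[]\ddagger \ell=\ell$; $(i::\ell)\ddagger []=i::\ell$; $(i_1::\ell_1)\ddagger(i_2::\ell_2)= i_1::(\ell_1\ddagger(i_2::\ell_2))$ if $i_1<i_2$, $=i_2::((i_1::\ell_1)\ddagger \ell_2)$ if $i_1>i_2$, undefined when the recursion reaches equal heads. The partial decrement $\downarrow$ is defined only on lists with all elements strictly positive: $\downarrow[]=[]$, $\downarrow((i+1)::\ell)=i::\downarrow\ell$. Typing rules: (ind) $\underline{i}:[i]$; (abs) if $t:0::\ell$ then $\lambda t:\downarrow\ell$ (when defined); (app) if $t_1:\ell_1$ and $t_2:\ell_2$ then $t_1\,t_2:\ell_1\ddagger\ell_2$ (when defined). -}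

module Defs where

open import Data.Nat using (ℕ; zero; suc; _+_; _<_; _≟_)
open import Data.List using (List; []; _∷_)
open import Data.Maybe using (Maybe; just; nothing; _>>=_)
open import Relation.Nullary using (yes; no)
open import Relation.Nullary.Decidable using (⌊_⌋)
open import Data.Nat using (_<ᵇ_)
open import Data.Bool using (if_then_else_)
open import Relation.Binary.PropositionalEquality using (_≡_)
open import Data.Product using (_×_)

data Term : Set where
  var : ℕ → Term
  lam : Term → Term
  app : Term → Term → Term

-- Closedness: `ClosedUnder d t` means every index occurrence in t, lying
-- under d outer abstractions plus those inside t, is bound.
data ClosedUnder : ℕ → Term → Set where
  c-var : ∀ {d n} → n < d → ClosedUnder d (var n)
  c-lam : ∀ {d t} → ClosedUnder (suc d) t → ClosedUnder d (lam t)
  c-app : ∀ {d t u} → ClosedUnder d t → ClosedUnder d u → ClosedUnder d (app t u)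

Closed : Term → Set
Closed t = ClosedUnder 0 t

-- occ k t : number of index occurrences in t referring to the abstraction
-- enclosing t at de Bruijn distance k (k = 0: the immediately enclosing one).
occ : ℕ → Term → ℕ
occ k (var n) with n ≟ k
... | yes _ = 1
... | no _ = 0
occ k (lam t) = occ (suc k) t
occ k (app t u) = occ k t + occ k u

data EveryAbsUsedOnce : Term → Set where
  l-var : ∀ {n} → EveryAbsUsedOnce (var n)
  l-lam : ∀ {t} → occ 0 t ≡ 1 → EveryAbsUsedOnce t → EveryAbsUsedOnce (lam t)
  l-app : ∀ {t u} → EveryAbsUsedOnce t → EveryAbsUsedOnce u → EveryAbsUsedOnce (app t u)

ClosedLinear : Term → Set
ClosedLinear t = Closed t × EveryAbsUsedOnce t

LType : Set
LType = List ℕ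

-- partial merge ‡ (merge-cons i₁ l₁ i₂ l₂ is (i₁ ∷ l₁) ‡ (i₂ ∷ l₂);
-- split into two functions only to make termination evident)
merge-cons : ℕ → LType → ℕ → LType → Maybe LType
merge-cons₁ : ℕ → LType → ℕ → LType → Maybe LType
merge-cons₂ : ℕ → LType → LType → Maybe LType
merge-cons i₁ l₁ i₂ l₂ with i₁ <ᵇ i₂ | i₂ <ᵇ i₁
... | Data.Bool.true  | _ = Data.Maybe.map (i₁ ∷_) (merge-cons₁ i₂ l₂ i₁ l₁)
... | Data.Bool.false | Data.Bool.true = Data.Maybe.map (i₂ ∷_) (merge-cons₂ i₁ l₁ l₂)
... | Data.Bool.false | Data.Bool.false = nothing
-- merge-cons₂ i₁ l₁ l₂ = (i₁ ∷ l₁) ‡ l₂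
merge-cons₂ i₁ l₁ [] = just (i₁ ∷ l₁)
merge-cons₂ i₁ l₁ (j ∷ l₂) = merge-cons i₁ l₁ j l₂
-- merge-cons₁ i₂ l₂ i₁ l₁ = l₁ ‡ (i₂ ∷ l₂)
merge-cons₁ i₂ l₂ i₁ [] = just (i₂ ∷ l₂)
merge-cons₁ i₂ l₂ i₁ (j ∷ l₁) = merge-cons j l₁ i₂ l₂

merge : LType → LType → Maybe LType
merge [] l = just l
merge (i ∷ l) [] = just (i ∷ l)
merge (i₁ ∷ l₁) (i₂ ∷ l₂) = merge-cons i₁ l₁ i₂ l₂

decr : LType → Maybe LType
decr [] = just []
decr (zero ∷ l) = nothing
decr (suc i ∷ l) = Data.Maybe.map (i ∷_) (decr l)

data _∶_ : Term → LType → Set where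
  ind-rule : ∀ i → var i ∶ (i ∷ [])
  abs-rule : ∀ {t ℓ ℓ'} → t ∶ (0 ∷ ℓ) → decr ℓ ≡ just ℓ' → lam t ∶ ℓ'
  app-rule : ∀ {t₁ t₂ ℓ₁ ℓ₂ ℓ} → t₁ ∶ ℓ₁ → t₂ ∶ ℓ₂ → merge ℓ₁ ℓ₂ ≡ just ℓ → app t₁ t₂ ∶ ℓ

-- The L-type of a term records its free indices: every index k has as many
-- occurrences in t as in its type ℓ (merge is a union and decrement a shift),
-- so in λ t : ↓ℓ the bound index 0 occurs exactly once in t, and the indices
-- of ℓ bound the free indices of t.  Conversely, a linear term closed under d
-- binders has as its type the increasing list of those k < d occurring in it;
-- linearity makes the supports of the two sides of an application disjoint,
-- which is what keeps their merge defined.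
module Submission where

open import Defs
open import Data.List using ([])
open import Function.Bundles using (_⇔_)

open import Data.Bool using (true; false)
open import Data.List using (_∷_; _++_; map)
open import Data.List.Properties using (map-++)
open import Data.List.Relation.Unary.All using (All; []; _∷_)
open import Data.List.Relation.Unary.All.Properties using (++⁻)
open import Data.List.Relation.Binary.Permutation.Propositional using (_↭_; prep; ↭-sym; ↭-trans)
open import Data.List.Relation.Binary.Permutation.Propositional.Properties
  using (All-resp-↭; shift; ++-identityʳ; map⁺)
open import Data.Maybe using (Maybe; just; nothing)
import Data.Maybe as Maybe
open import Data.Nat using (ℕ; zero; suc; _+_; _<_; _≤_; _≟_; _<ᵇ_; z≤n; s≤s)
open import Data.Nat.ListAction using (sum)
open import Data.Nat.ListAction.Properties using (sum-++; sum-↭)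
open import Data.Nat.Properties using (+-identityʳ; suc-injective; m+n≤o⇒m≤o; m+n≤o⇒n≤o)
open import Data.Product using (∃; _×_; _,_)
open import Function.Bundles using (mk⇔)
open import Relation.Nullary using (yes; no; ¬_; contradiction)
open import Relation.Binary.PropositionalEquality
  using (_≡_; refl; sym; trans; cong; cong₂; subst; ≢-sym; module ≡-Reasoning)
open ≡-Reasoning

occ-var-self : ∀ k → occ k (var k) ≡ 1
occ-var-self k with k ≟ k
... | yes _  = refl
... | no k≢k = contradiction refl k≢k

occ-var-other : ∀ {i k} → ¬ i ≡ k → occ k (var i) ≡ 0
occ-var-other {i} {k} i≢k with i ≟ k
... | yes i≡k = contradiction i≡k i≢k
... | no _    = refl

occ-var-suc : ∀ i k → occ (suc k) (var (suc i)) ≡ occ k (var i)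
occ-var-suc i k with i ≟ k
... | yes refl = occ-var-self (suc i)
... | no i≢k   = occ-var-other (λ e → i≢k (suc-injective e))

merge-cons₁≡merge : ∀ i₂ ℓ₂ i₁ ℓ₁ → merge-cons₁ i₂ ℓ₂ i₁ ℓ₁ ≡ merge ℓ₁ (i₂ ∷ ℓ₂)
merge-cons₁≡merge i₂ ℓ₂ i₁ []      = refl
merge-cons₁≡merge i₂ ℓ₂ i₁ (_ ∷ _) = refl

merge-cons₂≡merge : ∀ i₁ ℓ₁ ℓ₂ → merge-cons₂ i₁ ℓ₁ ℓ₂ ≡ merge (i₁ ∷ ℓ₁) ℓ₂
merge-cons₂≡merge i₁ ℓ₁ []      = refl
merge-cons₂≡merge i₁ ℓ₁ (_ ∷ _) = refl

map-cons≡just : ∀ {i ℓ} (m : Maybe LType) → Maybe.map (i ∷_) m ≡ just ℓ →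
                ∃ λ ℓ′ → m ≡ just ℓ′ × ℓ ≡ i ∷ ℓ′
map-cons≡just (just ℓ′) refl = ℓ′ , refl , refl

-- Recursion on the merged list ℓ, which loses its head in each recursive call.
merge⇒↭ : ∀ ℓ₁ ℓ₂ {ℓ} → merge ℓ₁ ℓ₂ ≡ just ℓ → ℓ ↭ ℓ₁ ++ ℓ₂
merge⇒↭ []           ℓ₂ refl = _↭_.refl
merge⇒↭ (i ∷ ℓ₁)     [] refl = ↭-sym (++-identityʳ (i ∷ ℓ₁))
merge⇒↭ l₁@(i₁ ∷ ℓ₁) l₂@(i₂ ∷ ℓ₂) e with i₁ <ᵇ i₂ | i₂ <ᵇ i₁
... | true  | _ with map-cons≡just (merge-cons₁ i₂ ℓ₂ i₁ ℓ₁) e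
...   | ℓ′ , e′ , refl = prep i₁ (merge⇒↭ ℓ₁ l₂ (trans (sym (merge-cons₁≡merge i₂ ℓ₂ i₁ ℓ₁)) e′))
merge⇒↭ l₁@(i₁ ∷ ℓ₁) l₂@(i₂ ∷ ℓ₂) e | false | true with map-cons≡just (merge-cons₂ i₁ ℓ₁ ℓ₂) e
...   | ℓ′ , e′ , refl = ↭-trans (prep i₂ (merge⇒↭ l₁ ℓ₂ (trans (sym (merge-cons₂≡merge i₁ ℓ₁ ℓ₂)) e′)))
                                 (↭-sym (shift i₂ l₁ ℓ₂))

decr⇒map-suc : ∀ ℓ {ℓ′} → decr ℓ ≡ just ℓ′ → ℓ ≡ map suc ℓ′
decr⇒map-suc []          refl = refl
decr⇒map-suc (zero ∷ ℓ)  ()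
decr⇒map-suc (suc i ∷ ℓ) e with decr ℓ in eq
decr⇒map-suc (suc i ∷ ℓ) refl | just ℓ′ = cong (suc i ∷_) (decr⇒map-suc ℓ eq)
decr⇒map-suc (suc i ∷ ℓ) ()   | nothing

decr-map-suc : ∀ ℓ → decr (map suc ℓ) ≡ just ℓ
decr-map-suc []      = refl
decr-map-suc (i ∷ ℓ) rewrite decr-map-suc ℓ = refl

multiplicity : ℕ → LType → ℕ
multiplicity k ℓ = sum (map (λ i → occ k (var i)) ℓ)

multiplicity-++ : ∀ k ℓ₁ ℓ₂ → multiplicity k (ℓ₁ ++ ℓ₂) ≡ multiplicity k ℓ₁ + multiplicity k ℓ₂
multiplicity-++ k ℓ₁ ℓ₂ = trans (cong sum (map-++ f ℓ₁ ℓ₂)) (sum-++ (map f ℓ₁) (map f ℓ₂))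
  where f = λ i → occ k (var i)

multiplicity-↭ : ∀ k {ℓ ℓ′} → ℓ ↭ ℓ′ → multiplicity k ℓ ≡ multiplicity k ℓ′
multiplicity-↭ k p = sum-↭ (map⁺ _ p)

multiplicity-suc-map-suc : ∀ k ℓ → multiplicity (suc k) (map suc ℓ) ≡ multiplicity k ℓ
multiplicity-suc-map-suc k []      = refl
multiplicity-suc-map-suc k (i ∷ ℓ) = cong₂ _+_ (occ-var-suc i k) (multiplicity-suc-map-suc k ℓ)

multiplicity-zero-map-suc : ∀ ℓ → multiplicity 0 (map suc ℓ) ≡ 0
multiplicity-zero-map-suc []      = refl
multiplicity-zero-map-suc (i ∷ ℓ) = multiplicity-zero-map-suc ℓ

occ≡multiplicity : ∀ {t ℓ} → t ∶ ℓ → ∀ k → occ k t ≡ multiplicity k ℓ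
occ≡multiplicity (ind-rule i) k = sym (+-identityʳ _)
occ≡multiplicity (abs-rule {t} {ℓ} {ℓ′} D e) k = begin
  occ (suc k) t                      ≡⟨ occ≡multiplicity D (suc k) ⟩
  multiplicity (suc k) ℓ             ≡⟨ cong (multiplicity (suc k)) (decr⇒map-suc ℓ e) ⟩
  multiplicity (suc k) (map suc ℓ′)  ≡⟨ multiplicity-suc-map-suc k ℓ′ ⟩
  multiplicity k ℓ′                  ∎
occ≡multiplicity (app-rule {t₁} {t₂} {ℓ₁} {ℓ₂} {ℓ} D₁ D₂ e) k = begin
  occ k t₁ + occ k t₂                      ≡⟨ cong₂ _+_ (occ≡multiplicity D₁ k) (occ≡multiplicity D₂ k) ⟩
  multiplicity k ℓ₁ + multiplicity k ℓ₂    ≡⟨ multiplicity-++ k ℓ₁ ℓ₂ ⟨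
  multiplicity k (ℓ₁ ++ ℓ₂)                ≡⟨ multiplicity-↭ k (merge⇒↭ ℓ₁ ℓ₂ e) ⟨
  multiplicity k ℓ                         ∎

typed⇒EveryAbsUsedOnce : ∀ {t ℓ} → t ∶ ℓ → EveryAbsUsedOnce t
typed⇒EveryAbsUsedOnce (ind-rule i) = l-var
typed⇒EveryAbsUsedOnce (abs-rule {t} {ℓ} {ℓ′} D e) = l-lam occ-bound≡1 (typed⇒EveryAbsUsedOnce D)
  where
  occ-bound≡1 : occ 0 t ≡ 1
  occ-bound≡1 = begin
    occ 0 t                          ≡⟨ occ≡multiplicity D 0 ⟩
    1 + multiplicity 0 ℓ             ≡⟨ cong (λ ℓ → 1 + multiplicity 0 ℓ) (decr⇒map-suc ℓ e) ⟩
    1 + multiplicity 0 (map suc ℓ′)  ≡⟨ cong suc (multiplicity-zero-map-suc ℓ′) ⟩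
    1                                ∎
typed⇒EveryAbsUsedOnce (app-rule D₁ D₂ e) = l-app (typed⇒EveryAbsUsedOnce D₁) (typed⇒EveryAbsUsedOnce D₂)

All<-map-suc : ∀ {d ℓ} → All (_< d) ℓ → All (_< suc d) (map suc ℓ)
All<-map-suc []       = []
All<-map-suc (p ∷ ps) = s≤s p ∷ All<-map-suc ps

typed⇒ClosedUnder : ∀ {t ℓ} d → t ∶ ℓ → All (_< d) ℓ → ClosedUnder d t
typed⇒ClosedUnder d (ind-rule i) (i<d ∷ []) = c-var i<d
typed⇒ClosedUnder d (abs-rule {ℓ = ℓ} D e) ℓ′<d =
  c-lam (typed⇒ClosedUnder (suc d) D
          (s≤s z≤n ∷ subst (All (_< suc d)) (sym (decr⇒map-suc ℓ e)) (All<-map-suc ℓ′<d)))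
typed⇒ClosedUnder d (app-rule {ℓ₁ = ℓ₁} {ℓ₂} D₁ D₂ e) ℓ<d
  with ++⁻ ℓ₁ (All-resp-↭ (merge⇒↭ ℓ₁ ℓ₂ e) ℓ<d)
... | ℓ₁<d , ℓ₂<d = c-app (typed⇒ClosedUnder d D₁ ℓ₁<d) (typed⇒ClosedUnder d D₂ ℓ₂<d)

consIfOne : ℕ → LType → LType
consIfOne 1 ℓ = 0 ∷ ℓ
consIfOne _ ℓ = ℓ

support : ℕ → (ℕ → ℕ) → LType
support zero    f = []
support (suc d) f = consIfOne (f 0) (map suc (support d (λ k → f (suc k))))

support-null : ∀ d f → (∀ k → f k ≡ 0) → support d f ≡ []
support-null zero    f f≡0 = refl
support-null (suc d) f f≡0
  rewrite f≡0 0 | support-null d (λ k → f (suc k)) (λ k → f≡0 (suc k)) = refl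

support-single : ∀ d n f → n < d → f n ≡ 1 → (∀ k → ¬ k ≡ n → f k ≡ 0) → support d f ≡ n ∷ []
support-single (suc d) zero f _ fn≡1 f≡0
  rewrite fn≡1 | support-null d (λ k → f (suc k)) (λ k → f≡0 (suc k) (λ ())) = refl
support-single (suc d) (suc n) f (s≤s n<d) fn≡1 f≡0
  rewrite f≡0 0 (λ ())
        | support-single d n (λ k → f (suc k)) n<d fn≡1 (λ k k≢n → f≡0 (suc k) (λ e → k≢n (suc-injective e)))
  = refl

map-suc-∷-comm : ∀ i (m : Maybe LType) →
                 Maybe.map (suc i ∷_) (Maybe.map (map suc) m) ≡ Maybe.map (map suc) (Maybe.map (i ∷_) m)
map-suc-∷-comm i (just ℓ) = refl
map-suc-∷-comm i nothing  = refl

mutual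
  merge-cons-map-suc : ∀ i₁ ℓ₁ i₂ ℓ₂ →
    merge-cons (suc i₁) (map suc ℓ₁) (suc i₂) (map suc ℓ₂) ≡ Maybe.map (map suc) (merge-cons i₁ ℓ₁ i₂ ℓ₂)
  merge-cons-map-suc i₁ ℓ₁ i₂ ℓ₂ with i₁ <ᵇ i₂ | i₂ <ᵇ i₁
  ... | true  | _    = trans (cong (Maybe.map (suc i₁ ∷_)) (merge-cons₁-map-suc i₂ ℓ₂ i₁ ℓ₁))
                             (map-suc-∷-comm i₁ (merge-cons₁ i₂ ℓ₂ i₁ ℓ₁))
  ... | false | true = trans (cong (Maybe.map (suc i₂ ∷_)) (merge-cons₂-map-suc i₁ ℓ₁ ℓ₂))
                             (map-suc-∷-comm i₂ (merge-cons₂ i₁ ℓ₁ ℓ₂))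
  ... | false | false = refl

  merge-cons₁-map-suc : ∀ i₂ ℓ₂ i₁ ℓ₁ →
    merge-cons₁ (suc i₂) (map suc ℓ₂) (suc i₁) (map suc ℓ₁) ≡ Maybe.map (map suc) (merge-cons₁ i₂ ℓ₂ i₁ ℓ₁)
  merge-cons₁-map-suc i₂ ℓ₂ i₁ []       = refl
  merge-cons₁-map-suc i₂ ℓ₂ i₁ (j ∷ ℓ₁) = merge-cons-map-suc j ℓ₁ i₂ ℓ₂

  merge-cons₂-map-suc : ∀ i₁ ℓ₁ ℓ₂ →
    merge-cons₂ (suc i₁) (map suc ℓ₁) (map suc ℓ₂) ≡ Maybe.map (map suc) (merge-cons₂ i₁ ℓ₁ ℓ₂)
  merge-cons₂-map-suc i₁ ℓ₁ []       = refl
  merge-cons₂-map-suc i₁ ℓ₁ (j ∷ ℓ₂) = merge-cons-map-suc i₁ ℓ₁ j ℓ₂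

merge-map-suc : ∀ ℓ₁ ℓ₂ → merge (map suc ℓ₁) (map suc ℓ₂) ≡ Maybe.map (map suc) (merge ℓ₁ ℓ₂)
merge-map-suc []        ℓ₂        = refl
merge-map-suc (_ ∷ _)   []        = refl
merge-map-suc (i₁ ∷ ℓ₁) (i₂ ∷ ℓ₂) = merge-cons-map-suc i₁ ℓ₁ i₂ ℓ₂

merge-0∷-map-sucˡ : ∀ ℓ₁ ℓ₂ → merge (0 ∷ ℓ₁) (map suc ℓ₂) ≡ Maybe.map (0 ∷_) (merge ℓ₁ (map suc ℓ₂))
merge-0∷-map-sucˡ []      []       = refl
merge-0∷-map-sucˡ (_ ∷ _) []       = refl
merge-0∷-map-sucˡ ℓ₁      (i ∷ ℓ₂) = cong (Maybe.map (0 ∷_)) (merge-cons₁≡merge (suc i) (map suc ℓ₂) 0 ℓ₁)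

merge-0∷-map-sucʳ : ∀ ℓ₁ ℓ₂ → merge (map suc ℓ₁) (0 ∷ ℓ₂) ≡ Maybe.map (0 ∷_) (merge (map suc ℓ₁) ℓ₂)
merge-0∷-map-sucʳ []       ℓ₂ = refl
merge-0∷-map-sucʳ (i ∷ ℓ₁) ℓ₂ = cong (Maybe.map (0 ∷_)) (merge-cons₂≡merge (suc i) (map suc ℓ₁) ℓ₂)

merge-consIfOne : ∀ a b ℓ₁ ℓ₂ {ℓ} → a + b ≤ 1 → merge ℓ₁ ℓ₂ ≡ just ℓ →
  merge (consIfOne a (map suc ℓ₁)) (consIfOne b (map suc ℓ₂)) ≡ just (consIfOne (a + b) (map suc ℓ))
merge-consIfOne 0 0 ℓ₁ ℓ₂ _ e = trans (merge-map-suc ℓ₁ ℓ₂) (cong (Maybe.map (map suc)) e)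
merge-consIfOne 0 1 ℓ₁ ℓ₂ _ e =
  trans (merge-0∷-map-sucʳ ℓ₁ (map suc ℓ₂)) (cong (Maybe.map (0 ∷_)) (merge-consIfOne 0 0 ℓ₁ ℓ₂ z≤n e))
merge-consIfOne 1 0 ℓ₁ ℓ₂ _ e =
  trans (merge-0∷-map-sucˡ (map suc ℓ₁) ℓ₂) (cong (Maybe.map (0 ∷_)) (merge-consIfOne 0 0 ℓ₁ ℓ₂ z≤n e))
merge-consIfOne 0             (suc (suc _)) _ _ (s≤s ()) _
merge-consIfOne 1             (suc _)       _ _ (s≤s ()) _
merge-consIfOne (suc (suc _)) _             _ _ (s≤s ()) _

support-+ : ∀ d f g → (∀ k → k < d → f k + g k ≤ 1) →
            merge (support d f) (support d g) ≡ just (support d (λ k → f k + g k))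
support-+ zero    f g _     = refl
support-+ (suc d) f g f+g≤1 =
  merge-consIfOne (f 0) (g 0) _ _ (f+g≤1 0 (s≤s z≤n))
    (support-+ d (λ k → f (suc k)) (λ k → g (suc k)) (λ k k<d → f+g≤1 (suc k) (s≤s k<d)))

typed-support : ∀ d t → ClosedUnder d t → EveryAbsUsedOnce t → (∀ k → k < d → occ k t ≤ 1) →
                t ∶ support d (λ k → occ k t)
typed-support d (var n) (c-var n<d) _ _ =
  subst (var n ∶_)
        (sym (support-single d n (λ k → occ k (var n)) n<d (occ-var-self n) (λ k k≢n → occ-var-other (≢-sym k≢n))))
        (ind-rule n)
typed-support d (lam t) (c-lam closed) (l-lam occ0≡1 linear) occ≤1 =
  abs-rule (subst (λ a → t ∶ consIfOne a (map suc ℓ)) occ0≡1 (typed-support (suc d) t closed linear occ′≤1))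
           (decr-map-suc ℓ)
  where
  ℓ : LType
  ℓ = support d (λ k → occ (suc k) t)

  occ′≤1 : ∀ k → k < suc d → occ k t ≤ 1
  occ′≤1 zero    _         = subst (_≤ 1) (sym occ0≡1) (s≤s z≤n)
  occ′≤1 (suc k) (s≤s k<d) = occ≤1 k k<d
typed-support d (app t u) (c-app closed₁ closed₂) (l-app linear₁ linear₂) occ≤1 =
  app-rule (typed-support d t closed₁ linear₁ (λ k k<d → m+n≤o⇒m≤o (occ k t) (occ≤1 k k<d)))
           (typed-support d u closed₂ linear₂ (λ k k<d → m+n≤o⇒n≤o (occ k t) (occ≤1 k k<d)))
           (support-+ d (λ k → occ k t) (λ k → occ k u) occ≤1)

proposition3 : (t : Term) → (t ∶ []) ⇔ ClosedLinear t
proposition3 t = mk⇔ (λ D → typed⇒ClosedUnder 0 D [] , typed⇒EveryAbsUsedOnce D)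
                     (λ (closed , linear) → typed-support 0 t closed linear (λ _ ()))
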